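{- In a dagger category $(\mathbb{X},\dagger)$, if $(r_1: A\to X_1, d_1: X_1\to Y_1, s_1: Y_1\to B)$ and $(r_2: A\to X_2, d_2: X_2\to Y_2, s_2: Y_2\to B)$ are both generalized compact singular value decompositions of $f: A\to B$, then there exist unique unitary maps $u: X_1\to X_2$ and $v: Y_1\to Y_2$ such that $r_1 u = r_2$, $d_1 v = u d_2$, and $s_1 = v s_2$.
   Context: Composition is in diagrammatic order. A dagger category is a category with an identity-on-objects contravariant involutive functor $\dagger$. Isometry: $s: A\to B$ with $ss^\dagger = 1_A$; coisometry: $r: A\to B$ with $r^\dagger r = 1_B$; unitary: $u$ with $uu^\dagger = 1$ and $u^\dagger u = 1$. A generalized compact singular value decomposition of $f: A \to B$ is a triple $(r: A\to X, d: X\to Y, s: Y\to B)$ with $r$ a coisometry, $d$ an isomorphism, $s$ an isometry, and $f = rds$. -}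

module Defs where

open import Level using (Level; suc; _⊔_)
open import Relation.Binary using (Rel; IsEquivalence)
open import Data.Product using (Σ; _×_; _,_)

-- A category with hom-setoids; composition in DIAGRAMMATIC order:
-- f ⨾ g : A ⇒ C  for  f : A ⇒ B , g : B ⇒ C  ("first f, then g").
record Category (o ℓ e : Level) : Set (suc (o ⊔ ℓ ⊔ e)) where
  infix  4 _≈_
  infixr 9 _⨾_
  field
    Obj   : Set o
    _⇒_   : Obj → Obj → Set ℓ
    _≈_   : ∀ {A B} → Rel (A ⇒ B) e
    id    : ∀ {A} → A ⇒ A
    _⨾_   : ∀ {A B C} → A ⇒ B → B ⇒ C → A ⇒ C
    equiv     : ∀ {A B} → IsEquivalence (_≈_ {A} {B})
    ⨾-resp-≈  : ∀ {A B C} {f f′ : A ⇒ B} {g g′ : B ⇒ C} →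
                f ≈ f′ → g ≈ g′ → f ⨾ g ≈ f′ ⨾ g′
    assoc     : ∀ {A B C D} {f : A ⇒ B} {g : B ⇒ C} {h : C ⇒ D} →
                (f ⨾ g) ⨾ h ≈ f ⨾ (g ⨾ h)
    identityˡ : ∀ {A B} {f : A ⇒ B} → id ⨾ f ≈ f
    identityʳ : ∀ {A B} {f : A ⇒ B} → f ⨾ id ≈ f

record DaggerCategory (o ℓ e : Level) : Set (suc (o ⊔ ℓ ⊔ e)) where
  field
    category : Category o ℓ e
  open Category category public
  field
    _† : ∀ {A B} → A ⇒ B → B ⇒ A
    †-resp-≈   : ∀ {A B} {f g : A ⇒ B} → f ≈ g → f † ≈ g †
    †-identity : ∀ {A} → (id {A}) † ≈ id
    †-homo     : ∀ {A B C} {f : A ⇒ B} {g : B ⇒ C} → (f ⨾ g) † ≈ g † ⨾ f †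
    †-involutive : ∀ {A B} {f : A ⇒ B} → (f †) † ≈ f

module _ {o ℓ e} (𝕏 : DaggerCategory o ℓ e) where
  open DaggerCategory 𝕏

  IsIsometry : ∀ {A B} → A ⇒ B → Set e
  IsIsometry s = s ⨾ s † ≈ id

  IsCoisometry : ∀ {A B} → A ⇒ B → Set e
  IsCoisometry r = r † ⨾ r ≈ id

  IsUnitary : ∀ {A B} → A ⇒ B → Set e
  IsUnitary u = (u ⨾ u † ≈ id) × (u † ⨾ u ≈ id)

  IsIso : ∀ {A B} → A ⇒ B → Set (ℓ ⊔ e)
  IsIso {A} {B} d = Σ (B ⇒ A) λ d⁻¹ → (d ⨾ d⁻¹ ≈ id) × (d⁻¹ ⨾ d ≈ id)

  record GCSVD {A B : Obj} (f : A ⇒ B) : Set (o ⊔ ℓ ⊔ e) where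
    field
      X Y : Obj
      r   : A ⇒ X
      d   : X ⇒ Y
      s   : Y ⇒ B
      r-coisometry : IsCoisometry r
      d-iso        : IsIso d
      s-isometry   : IsIsometry s
      factor       : f ≈ r ⨾ d ⨾ s

{-# OPTIONS --safe #-}
-- The comparison maps are u = r₁† ⨾ r₂ and v = s₁ ⨾ s₂†. Each r is f ⨾ s† ⨾ d⁻¹
-- and each s is d⁻¹ ⨾ r† ⨾ f, so the projection r₁ ⨾ r₁† fixes f and hence r₂;
-- together with the symmetric fact this makes u unitary, and dually v. Uniqueness
-- holds because r ⨾ u′ ≈ r₂ forces u′ ≈ r₁† ⨾ r₂ (a coisometry is cancelled by its
-- dagger), and dually for v′.
module Submission where

open import Defs
open import Data.Product using (Σ; _×_; _,_; proj₁; proj₂)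
open import Relation.Binary using (Setoid; IsEquivalence)
import Relation.Binary.Reasoning.Setoid as SetoidReasoning

module DaggerProperties {o ℓ e} (𝕏 : DaggerCategory o ℓ e) where
  open DaggerCategory 𝕏
  open module ≈ {A B} = IsEquivalence (equiv {A} {B}) public
    using () renaming (refl to ≈-refl; sym to ≈-sym; trans to ≈-trans)

  hom-setoid : Obj → Obj → Setoid ℓ e
  hom-setoid A B = record { Carrier = A ⇒ B ; _≈_ = _≈_ ; isEquivalence = equiv }

  module HomReasoning {A B : Obj} = SetoidReasoning (hom-setoid A B)

  ⨾-congˡ : ∀ {A B C} {f : A ⇒ B} {g g′ : B ⇒ C} → g ≈ g′ → f ⨾ g ≈ f ⨾ g′
  ⨾-congˡ = ⨾-resp-≈ ≈-refl

  ⨾-congʳ : ∀ {A B C} {f f′ : A ⇒ B} {g : B ⇒ C} → f ≈ f′ → f ⨾ g ≈ f′ ⨾ g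
  ⨾-congʳ p = ⨾-resp-≈ p ≈-refl

  cancelˡ : ∀ {A B C} {g : A ⇒ B} {h : B ⇒ A} {k : A ⇒ C} →
            g ⨾ h ≈ id → g ⨾ (h ⨾ k) ≈ k
  cancelˡ gh≈id = ≈-trans (≈-sym assoc) (≈-trans (⨾-congʳ gh≈id) identityˡ)

  cancelʳ : ∀ {A B C} {g : A ⇒ B} {h : B ⇒ A} {k : C ⇒ A} →
            g ⨾ h ≈ id → (k ⨾ g) ⨾ h ≈ k
  cancelʳ gh≈id = ≈-trans assoc (≈-trans (⨾-congˡ gh≈id) identityʳ)

  †-anti-†⨾ : ∀ {A B C} {f : B ⇒ A} {g : B ⇒ C} → (f † ⨾ g) † ≈ g † ⨾ f
  †-anti-†⨾ = ≈-trans †-homo (⨾-congˡ †-involutive)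

  †-anti-⨾† : ∀ {A B C} {f : A ⇒ B} {g : C ⇒ B} → (f ⨾ g †) † ≈ g ⨾ f †
  †-anti-⨾† = ≈-trans †-homo (⨾-congʳ †-involutive)

  unitary-intro : ∀ {A B} {u : A ⇒ B} {w : B ⇒ A} →
                  u † ≈ w → u ⨾ w ≈ id → w ⨾ u ≈ id → IsUnitary 𝕏 u
  unitary-intro u†≈w uw≈id wu≈id =
    ≈-trans (⨾-congˡ u†≈w) uw≈id , ≈-trans (⨾-congʳ u†≈w) wu≈id

  coisometry-cancelˡ : ∀ {A X Y} {r : A ⇒ X} {u : X ⇒ Y} {g : A ⇒ Y} →
                       IsCoisometry 𝕏 r → r ⨾ u ≈ g → u ≈ r † ⨾ g
  coisometry-cancelˡ r-co ru≈g = ≈-trans (≈-sym (cancelˡ r-co)) (⨾-congˡ ru≈g)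

  isometry-cancelʳ : ∀ {Y Z B} {s : Z ⇒ B} {v : Y ⇒ Z} {g : Y ⇒ B} →
                     IsIsometry 𝕏 s → g ≈ v ⨾ s → v ≈ g ⨾ s †
  isometry-cancelʳ s-iso g≈vs = ≈-trans (≈-sym (cancelʳ s-iso)) (⨾-congʳ (≈-sym g≈vs))

  †⨾-inverse : ∀ {A X₁ X₂} {r₁ : A ⇒ X₁} {r₂ : A ⇒ X₂} →
               IsCoisometry 𝕏 r₁ → r₂ ⨾ (r₂ † ⨾ r₁) ≈ r₁ →
               (r₁ † ⨾ r₂) ⨾ (r₂ † ⨾ r₁) ≈ id
  †⨾-inverse r₁-co r₂-absorbs-r₁ = ≈-trans assoc (≈-trans (⨾-congˡ r₂-absorbs-r₁) r₁-co)

  ⨾†-inverse : ∀ {Y₁ Y₂ B} {s₁ : Y₁ ⇒ B} {s₂ : Y₂ ⇒ B} →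
               IsIsometry 𝕏 s₁ → (s₁ ⨾ s₂ †) ⨾ s₂ ≈ s₁ →
               (s₁ ⨾ s₂ †) ⨾ (s₂ ⨾ s₁ †) ≈ id
  ⨾†-inverse s₁-iso s₂-absorbs-s₁ = ≈-trans (≈-sym assoc) (≈-trans (⨾-congʳ s₂-absorbs-s₁) s₁-iso)

  †⨾-unitary : ∀ {A X₁ X₂} {r₁ : A ⇒ X₁} {r₂ : A ⇒ X₂} →
               IsCoisometry 𝕏 r₁ → IsCoisometry 𝕏 r₂ →
               r₁ ⨾ (r₁ † ⨾ r₂) ≈ r₂ → r₂ ⨾ (r₂ † ⨾ r₁) ≈ r₁ →
               IsUnitary 𝕏 (r₁ † ⨾ r₂)
  †⨾-unitary r₁-co r₂-co r₁-absorbs-r₂ r₂-absorbs-r₁ =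
    unitary-intro †-anti-†⨾ (†⨾-inverse r₁-co r₂-absorbs-r₁) (†⨾-inverse r₂-co r₁-absorbs-r₂)

  ⨾†-unitary : ∀ {Y₁ Y₂ B} {s₁ : Y₁ ⇒ B} {s₂ : Y₂ ⇒ B} →
               IsIsometry 𝕏 s₁ → IsIsometry 𝕏 s₂ →
               (s₁ ⨾ s₂ †) ⨾ s₂ ≈ s₁ → (s₂ ⨾ s₁ †) ⨾ s₁ ≈ s₂ →
               IsUnitary 𝕏 (s₁ ⨾ s₂ †)
  ⨾†-unitary s₁-iso s₂-iso s₂-absorbs-s₁ s₁-absorbs-s₂ =
    unitary-intro †-anti-⨾† (⨾†-inverse s₁-iso s₂-absorbs-s₁) (⨾†-inverse s₂-iso s₁-absorbs-s₂)

module GCSVDProperties {o ℓ e} (𝕏 : DaggerCategory o ℓ e) where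
  open DaggerCategory 𝕏
  open DaggerProperties 𝕏

  module _ {A B : Obj} {f : A ⇒ B} (σ : GCSVD 𝕏 f) where
    open GCSVD σ
    open HomReasoning

    d⁻¹ : Y ⇒ X
    d⁻¹ = proj₁ d-iso

    r†⨾f≈d⨾s : r † ⨾ f ≈ d ⨾ s
    r†⨾f≈d⨾s = ≈-trans (⨾-congˡ factor) (cancelˡ r-coisometry)

    f⨾s†≈r⨾d : f ⨾ s † ≈ r ⨾ d
    f⨾s†≈r⨾d = begin
      f ⨾ s †             ≈⟨ ⨾-congʳ (≈-trans factor (≈-sym assoc)) ⟩
      ((r ⨾ d) ⨾ s) ⨾ s † ≈⟨ cancelʳ s-isometry ⟩
      r ⨾ d               ∎

    r-absorbs-f : r ⨾ (r † ⨾ f) ≈ f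
    r-absorbs-f = ≈-trans (⨾-congˡ r†⨾f≈d⨾s) (≈-sym factor)

    s-absorbs-f : (f ⨾ s †) ⨾ s ≈ f
    s-absorbs-f = ≈-trans (⨾-congʳ f⨾s†≈r⨾d) (≈-trans assoc (≈-sym factor))

    r≈f⨾s†⨾d⁻¹ : r ≈ f ⨾ (s † ⨾ d⁻¹)
    r≈f⨾s†⨾d⁻¹ = ≈-sym (begin
      f ⨾ (s † ⨾ d⁻¹) ≈⟨ ≈-sym assoc ⟩
      (f ⨾ s †) ⨾ d⁻¹ ≈⟨ ⨾-congʳ f⨾s†≈r⨾d ⟩
      (r ⨾ d) ⨾ d⁻¹   ≈⟨ cancelʳ (proj₁ (proj₂ d-iso)) ⟩
      r               ∎)

    s≈d⁻¹⨾r†⨾f : s ≈ (d⁻¹ ⨾ r †) ⨾ f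
    s≈d⁻¹⨾r†⨾f = ≈-sym (begin
      (d⁻¹ ⨾ r †) ⨾ f ≈⟨ assoc ⟩
      d⁻¹ ⨾ (r † ⨾ f) ≈⟨ ⨾-congˡ r†⨾f≈d⨾s ⟩
      d⁻¹ ⨾ (d ⨾ s)   ≈⟨ cancelˡ (proj₂ (proj₂ d-iso)) ⟩
      s               ∎)

  module _ {A B : Obj} {f : A ⇒ B} (σ₁ σ₂ : GCSVD 𝕏 f) where
    private
      module S₁ = GCSVD σ₁
      module S₂ = GCSVD σ₂
    open HomReasoning

    r-absorbs-r : S₁.r ⨾ (S₁.r † ⨾ S₂.r) ≈ S₂.r
    r-absorbs-r = begin
      S₁.r ⨾ (S₁.r † ⨾ S₂.r)     ≈⟨ ⨾-congˡ (⨾-congˡ (r≈f⨾s†⨾d⁻¹ σ₂)) ⟩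
      S₁.r ⨾ (S₁.r † ⨾ (f ⨾ t))  ≈⟨ ⨾-congˡ (≈-sym assoc) ⟩
      S₁.r ⨾ ((S₁.r † ⨾ f) ⨾ t)  ≈⟨ ≈-sym assoc ⟩
      (S₁.r ⨾ (S₁.r † ⨾ f)) ⨾ t  ≈⟨ ⨾-congʳ (r-absorbs-f σ₁) ⟩
      f ⨾ t                      ≈⟨ ≈-sym (r≈f⨾s†⨾d⁻¹ σ₂) ⟩
      S₂.r                       ∎
      where t = S₂.s † ⨾ d⁻¹ σ₂

    s-absorbs-s : (S₁.s ⨾ S₂.s †) ⨾ S₂.s ≈ S₁.s
    s-absorbs-s = begin
      (S₁.s ⨾ S₂.s †) ⨾ S₂.s       ≈⟨ ⨾-congʳ (⨾-congʳ (s≈d⁻¹⨾r†⨾f σ₁)) ⟩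
      ((t ⨾ f) ⨾ S₂.s †) ⨾ S₂.s    ≈⟨ ⨾-congʳ assoc ⟩
      (t ⨾ (f ⨾ S₂.s †)) ⨾ S₂.s    ≈⟨ assoc ⟩
      t ⨾ ((f ⨾ S₂.s †) ⨾ S₂.s)    ≈⟨ ⨾-congˡ (s-absorbs-f σ₂) ⟩
      t ⨾ f                        ≈⟨ ≈-sym (s≈d⁻¹⨾r†⨾f σ₁) ⟩
      S₁.s                         ∎
      where t = d⁻¹ σ₁ ⨾ S₁.r †

    intertwines : S₁.d ⨾ (S₁.s ⨾ S₂.s †) ≈ (S₁.r † ⨾ S₂.r) ⨾ S₂.d
    intertwines = begin
      S₁.d ⨾ (S₁.s ⨾ S₂.s †)   ≈⟨ ≈-sym assoc ⟩
      (S₁.d ⨾ S₁.s) ⨾ S₂.s †   ≈⟨ ⨾-congʳ (≈-sym (r†⨾f≈d⨾s σ₁)) ⟩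
      (S₁.r † ⨾ f) ⨾ S₂.s †    ≈⟨ assoc ⟩
      S₁.r † ⨾ (f ⨾ S₂.s †)    ≈⟨ ⨾-congˡ (f⨾s†≈r⨾d σ₂) ⟩
      S₁.r † ⨾ (S₂.r ⨾ S₂.d)   ≈⟨ ≈-sym assoc ⟩
      (S₁.r † ⨾ S₂.r) ⨾ S₂.d   ∎

mainTheorem10 : ∀ {o ℓ e} (𝕏 : DaggerCategory o ℓ e) →
    let open DaggerCategory 𝕏 in
    ∀ {A B : Obj} {f : A ⇒ B} (σ₁ σ₂ : GCSVD 𝕏 f) →
    let module S₁ = GCSVD σ₁
        module S₂ = GCSVD σ₂
    in Σ (S₁.X ⇒ S₂.X) λ u → Σ (S₁.Y ⇒ S₂.Y) λ v →
         (IsUnitary 𝕏 u × IsUnitary 𝕏 v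
          × S₁.r ⨾ u ≈ S₂.r × S₁.d ⨾ v ≈ u ⨾ S₂.d × S₁.s ≈ v ⨾ S₂.s)
         × (∀ (u′ : S₁.X ⇒ S₂.X) (v′ : S₁.Y ⇒ S₂.Y) →
              IsUnitary 𝕏 u′ → IsUnitary 𝕏 v′ →
              S₁.r ⨾ u′ ≈ S₂.r → S₁.d ⨾ v′ ≈ u′ ⨾ S₂.d → S₁.s ≈ v′ ⨾ S₂.s →
              (u′ ≈ u) × (v′ ≈ v))
mainTheorem10 𝕏 σ₁ σ₂ =
  S₁.r † ⨾ S₂.r , S₁.s ⨾ S₂.s † ,
  ( †⨾-unitary S₁.r-coisometry S₂.r-coisometry (r-absorbs-r σ₁ σ₂) (r-absorbs-r σ₂ σ₁)
  , ⨾†-unitary S₁.s-isometry S₂.s-isometry (s-absorbs-s σ₁ σ₂) (s-absorbs-s σ₂ σ₁)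
  , r-absorbs-r σ₁ σ₂
  , intertwines σ₁ σ₂
  , ≈-sym (s-absorbs-s σ₁ σ₂) )
  , λ _ _ _ _ r₁⨾u′≈r₂ _ s₁≈v′⨾s₂ →
      coisometry-cancelˡ S₁.r-coisometry r₁⨾u′≈r₂ , isometry-cancelʳ S₂.s-isometry s₁≈v′⨾s₂
  where
    open DaggerCategory 𝕏
    open DaggerProperties 𝕏
    open GCSVDProperties 𝕏
    module S₁ = GCSVD σ₁
    module S₂ = GCSVD σ₂
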